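{- (1) If $\Gamma;(\Omega,x{:}C);\Delta\vdash M:A$, then $(\Gamma,x{:}C);\Omega;\Delta\vdash M:A$. (2) If $\Gamma;\Omega;(\Delta,x{:}C)\vdash M:A$, then $(\Gamma,x{:}C);\Omega;\Delta\vdash M:A$.
   Context: Strict $\lambda$-calculus over a signature $\Sigma$. Labels $k\in\{1,0,u\}$; types $A::=a\mid A_1\to^kA_2$; terms $c\mid x\mid\lambda x^k{:}A.M\mid M_1M_2^k$. Contexts: finite sets of declarations with distinct variables; commas denote disjoint unions. Typing $\Gamma;\Omega;\Delta\vdash M:A$ ($\Gamma$ unrestricted, $\Omega$ irrelevant, $\Delta$ strict; pairwise disjoint): if $c{:}A\in\Sigma$ then $\Gamma;\Omega;\cdot\vdash c:A$; $(\Gamma,x{:}A);\Omega;\cdot\vdash x:A$; $\Gamma;\Omega;x{:}A\vdash x:A$ (no rule for $\Omega$); from $(\Gamma,x{:}A);\Omega;\Delta\vdash M:B$ infer $\Gamma;\Omega;\Delta\vdash\lambda x^u{:}A.M:A\to^uB$; from $\Gamma;(\Omega,x{:}A);\Delta\vdash M:B$ infer $\Gamma;\Omega;\Delta\vdash\lambda x^0{:}A.M:A\to^0B$; from $\Gamma;\Omega;(\Delta,x{:}A)\vdash M:B$ infer $\Gamma;\Omega;\Delta\vdash\lambda x^1{:}A.M:A\to^1B$; from $\Gamma;\Omega;\Delta\vdash M:A\to^uB$ and $(\Gamma,\Delta);\Omega;\cdot\vdash N:A$ infer $\Gamma;\Omega;\Delta\vdash MN^u:B$; from $\Gamma;\Omega;\Delta\vdash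 M:A\to^0B$ and $(\Gamma,\Omega,\Delta);\cdot;\cdot\vdash N:A$ infer $\Gamma;\Omega;\Delta\vdash MN^0:B$; from $(\Gamma,\Delta_N);\Omega;\Delta_M\vdash M:A\to^1B$ and $(\Gamma,\Delta_M);\Omega;\Delta_N\vdash N:A$ infer $\Gamma;\Omega;(\Delta_M,\Delta_N)\vdash MN^1:B$. -}

module Defs where

open import Data.Nat using (ℕ)
open import Data.Product using (_×_; _,_; proj₁)
open import Data.List using (List; []; _∷_; _++_; map)
open import Data.List.Membership.Propositional using (_∈_; _∉_)
open import Data.List.Relation.Unary.Unique.Propositional using (Unique)
open import Data.List.Relation.Binary.Permutation.Propositional using (_↭_)

data Label : Set where
  one zero u : Label

Var : Set
Var = ℕ

Const : Set
Const = ℕ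

data Ty : Set where
  base : ℕ → Ty
  _⟶[_]_ : Ty → Label → Ty → Ty

data Tm : Set where
  con : Const → Tm
  var : Var → Tm
  lam : Label → Var → Ty → Tm → Tm
  app : Label → Tm → Tm → Tm

Sig : Set
Sig = List (Const × Ty)

-- Contexts: finite lists of declarations; "Γ, x:A" is x:A ∷ Γ (with x fresh),
-- and a disjoint union "Δ₁, Δ₂" is Δ₁ ++ Δ₂ (up to permutation where needed).
Ctx : Set
Ctx = List (Var × Ty)

dom : Ctx → List Var
dom = map proj₁

WF : Ctx → Ctx → Ctx → Set
WF Γ Ω Δ = Unique (dom (Γ ++ Ω ++ Δ))

-- Typing  Γ ; Ω ; Δ ⊢ M : A  (Γ unrestricted, Ω irrelevant, Δ strict).
-- Bound variables must be fresh w.r.t. the current contexts (so that the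
-- extended context is again a disjoint union).
data _∣_⨾_⨾_⊢_∶_ (Σ : Sig) : Ctx → Ctx → Ctx → Tm → Ty → Set where
  t-con : ∀ {Γ Ω c A} → (c , A) ∈ Σ → Σ ∣ Γ ⨾ Ω ⨾ [] ⊢ con c ∶ A
  t-varu : ∀ {Γ Ω x A} → (x , A) ∈ Γ → Σ ∣ Γ ⨾ Ω ⨾ [] ⊢ var x ∶ A
  t-var1 : ∀ {Γ Ω x A} → Σ ∣ Γ ⨾ Ω ⨾ ((x , A) ∷ []) ⊢ var x ∶ A
  t-lamu : ∀ {Γ Ω Δ x A B M} → x ∉ dom (Γ ++ Ω ++ Δ) →
    Σ ∣ ((x , A) ∷ Γ) ⨾ Ω ⨾ Δ ⊢ M ∶ B →
    Σ ∣ Γ ⨾ Ω ⨾ Δ ⊢ lam u x A M ∶ (A ⟶[ u ] B)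
  t-lam0 : ∀ {Γ Ω Δ x A B M} → x ∉ dom (Γ ++ Ω ++ Δ) →
    Σ ∣ Γ ⨾ ((x , A) ∷ Ω) ⨾ Δ ⊢ M ∶ B →
    Σ ∣ Γ ⨾ Ω ⨾ Δ ⊢ lam zero x A M ∶ (A ⟶[ zero ] B)
  t-lam1 : ∀ {Γ Ω Δ x A B M} → x ∉ dom (Γ ++ Ω ++ Δ) →
    Σ ∣ Γ ⨾ Ω ⨾ ((x , A) ∷ Δ) ⊢ M ∶ B →
    Σ ∣ Γ ⨾ Ω ⨾ Δ ⊢ lam one x A M ∶ (A ⟶[ one ] B)
  t-appu : ∀ {Γ Ω Δ M N A B} →
    Σ ∣ Γ ⨾ Ω ⨾ Δ ⊢ M ∶ (A ⟶[ u ] B) →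
    Σ ∣ (Γ ++ Δ) ⨾ Ω ⨾ [] ⊢ N ∶ A →
    Σ ∣ Γ ⨾ Ω ⨾ Δ ⊢ app u M N ∶ B
  t-app0 : ∀ {Γ Ω Δ M N A B} →
    Σ ∣ Γ ⨾ Ω ⨾ Δ ⊢ M ∶ (A ⟶[ zero ] B) →
    Σ ∣ (Γ ++ Ω ++ Δ) ⨾ [] ⨾ [] ⊢ N ∶ A →
    Σ ∣ Γ ⨾ Ω ⨾ Δ ⊢ app zero M N ∶ B
  t-app1 : ∀ {Γ Ω Δ ΔM ΔN M N A B} →
    Δ ↭ (ΔM ++ ΔN) →
    Σ ∣ (Γ ++ ΔN) ⨾ Ω ⨾ ΔM ⊢ M ∶ (A ⟶[ one ] B) →
    Σ ∣ (Γ ++ ΔM) ⨾ Ω ⨾ ΔN ⊢ N ∶ A →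
    Σ ∣ Γ ⨾ Ω ⨾ Δ ⊢ app one M N ∶ B

{-# OPTIONS --safe #-}
-- Induction on the derivation, generalised so that the promoted declaration
-- may sit anywhere in its context up to permutation: the λ⁰ and λ¹ rules push
-- new declarations in front of it, so the induction hypothesis must be
-- applied at a permuted context.  Irrelevant declarations are never consumed
-- by a variable rule, and a strict one consumed by the linear variable rule
-- is then found by the unrestricted one.  In an application M N¹ the strict
-- declaration belongs to exactly one of the two halves of the split; that half
-- is handled by induction, and in the other half it is already unrestricted.
module Submission where

open import Level using (Level)
open import Data.Product using (_×_; _,_; proj₁; ∃-syntax)
open import Data.Sum using (_⊎_; inj₁; inj₂)
open import Data.Empty using (⊥-elim)
open import Relation.Binary.PropositionalEquality using (refl)
open import Data.List using ([]; _∷_; _++_)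
open import Data.List.Relation.Unary.Any using (here; there)
open import Data.List.Membership.Propositional using (_∉_)
open import Data.List.Membership.Propositional.Properties using (∈-∃++; ∈-++⁻)
open import Data.List.Relation.Binary.Permutation.Propositional
open import Data.List.Relation.Binary.Permutation.Propositional.Properties

open import Defs

private
  variable
    a : Level
    X : Set a

↭-shiftˡ : ∀ {v : X} xs {ys ys'} → ys ↭ v ∷ ys' → xs ++ ys ↭ v ∷ xs ++ ys'
↭-shiftˡ xs {ys' = ys'} p = ↭-trans (++⁺ˡ xs p) (shift _ xs ys')

∷-↭-++-split : ∀ {v : X} {xs ys zs} → v ∷ xs ↭ ys ++ zs →
  (∃[ ys' ] ys ↭ v ∷ ys' × xs ↭ ys' ++ zs) ⊎
  (∃[ zs' ] zs ↭ v ∷ zs' × xs ↭ ys ++ zs')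
∷-↭-++-split {ys = ys} {zs} p with ∈-++⁻ ys (∈-resp-↭ p (here refl))
... | inj₁ v∈ys with as , bs , refl ← ∈-∃++ v∈ys =
  inj₁ (as ++ bs , shift _ as bs , drop-∷ (↭-trans p (++⁺ʳ zs (shift _ as bs))))
... | inj₂ v∈zs with as , bs , refl ← ∈-∃++ v∈zs =
  inj₂ (as ++ bs , shift _ as bs , drop-∷ (↭-trans p (↭-shiftˡ ys (shift _ as bs))))

∉-dom-resp-↭ : ∀ {y : Var} {Θ Θ' : Ctx} → Θ ↭ Θ' → y ∉ dom Θ → y ∉ dom Θ'
∉-dom-resp-↭ p y∉Θ y∈Θ' = y∉Θ (∈-resp-↭ (↭-sym (map⁺ proj₁ p)) y∈Θ')

⊢-resp-↭ : ∀ {Σ Γ Ω Δ Γ' Ω' Δ' M A} → Γ ↭ Γ' → Ω ↭ Ω' → Δ ↭ Δ' →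
  Σ ∣ Γ ⨾ Ω ⨾ Δ ⊢ M ∶ A → Σ ∣ Γ' ⨾ Ω' ⨾ Δ' ⊢ M ∶ A
⊢-resp-↭ pΓ pΩ pΔ (t-con c∈Σ) with refl ← ↭-empty-inv (↭-sym pΔ) = t-con c∈Σ
⊢-resp-↭ pΓ pΩ pΔ (t-varu x∈Γ) with refl ← ↭-empty-inv (↭-sym pΔ) =
  t-varu (∈-resp-↭ pΓ x∈Γ)
⊢-resp-↭ pΓ pΩ pΔ t-var1 with refl ← ↭-singleton-inv (↭-sym pΔ) = t-var1
⊢-resp-↭ pΓ pΩ pΔ (t-lamu fr D) =
  t-lamu (∉-dom-resp-↭ (++⁺ pΓ (++⁺ pΩ pΔ)) fr) (⊢-resp-↭ (↭-prep _ pΓ) pΩ pΔ D)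
⊢-resp-↭ pΓ pΩ pΔ (t-lam0 fr D) =
  t-lam0 (∉-dom-resp-↭ (++⁺ pΓ (++⁺ pΩ pΔ)) fr) (⊢-resp-↭ pΓ (↭-prep _ pΩ) pΔ D)
⊢-resp-↭ pΓ pΩ pΔ (t-lam1 fr D) =
  t-lam1 (∉-dom-resp-↭ (++⁺ pΓ (++⁺ pΩ pΔ)) fr) (⊢-resp-↭ pΓ pΩ (↭-prep _ pΔ) D)
⊢-resp-↭ pΓ pΩ pΔ (t-appu DM DN) =
  t-appu (⊢-resp-↭ pΓ pΩ pΔ DM) (⊢-resp-↭ (++⁺ pΓ pΔ) pΩ ↭-refl DN)
⊢-resp-↭ pΓ pΩ pΔ (t-app0 DM DN) =
  t-app0 (⊢-resp-↭ pΓ pΩ pΔ DM) (⊢-resp-↭ (++⁺ pΓ (++⁺ pΩ pΔ)) ↭-refl ↭-refl DN)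
⊢-resp-↭ pΓ pΩ pΔ (t-app1 split DM DN) =
  t-app1 (↭-trans (↭-sym pΔ) split)
    (⊢-resp-↭ (++⁺ʳ _ pΓ) pΩ ↭-refl DM) (⊢-resp-↭ (++⁺ʳ _ pΓ) pΩ ↭-refl DN)

irrelevant⇒unrestricted : ∀ {Σ Γ Ω Ω' Δ M A v} → Ω ↭ v ∷ Ω' →
  Σ ∣ Γ ⨾ Ω ⨾ Δ ⊢ M ∶ A → Σ ∣ (v ∷ Γ) ⨾ Ω' ⨾ Δ ⊢ M ∶ A
irrelevant⇒unrestricted p (t-con c∈Σ) = t-con c∈Σ
irrelevant⇒unrestricted p (t-varu x∈Γ) = t-varu (there x∈Γ)
irrelevant⇒unrestricted p t-var1 = t-var1
irrelevant⇒unrestricted {Γ = Γ} {Δ = Δ} p (t-lamu fr D) =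
  t-lamu (∉-dom-resp-↭ (↭-shiftˡ Γ (++⁺ʳ Δ p)) fr)
    (⊢-resp-↭ (↭-swap _ _ ↭-refl) ↭-refl ↭-refl (irrelevant⇒unrestricted p D))
irrelevant⇒unrestricted {Γ = Γ} {Δ = Δ} p (t-lam0 fr D) =
  t-lam0 (∉-dom-resp-↭ (↭-shiftˡ Γ (++⁺ʳ Δ p)) fr)
    (irrelevant⇒unrestricted (↭-shiftˡ (_ ∷ []) p) D)
irrelevant⇒unrestricted {Γ = Γ} {Δ = Δ} p (t-lam1 fr D) =
  t-lam1 (∉-dom-resp-↭ (↭-shiftˡ Γ (++⁺ʳ Δ p)) fr) (irrelevant⇒unrestricted p D)
irrelevant⇒unrestricted p (t-appu DM DN) =
  t-appu (irrelevant⇒unrestricted p DM) (irrelevant⇒unrestricted p DN)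
irrelevant⇒unrestricted {Γ = Γ} {Δ = Δ} p (t-app0 DM DN) =
  t-app0 (irrelevant⇒unrestricted p DM)
    (⊢-resp-↭ (↭-shiftˡ Γ (++⁺ʳ Δ p)) ↭-refl ↭-refl DN)
irrelevant⇒unrestricted p (t-app1 split DM DN) =
  t-app1 split (irrelevant⇒unrestricted p DM) (irrelevant⇒unrestricted p DN)

strict⇒unrestricted : ∀ {Σ Γ Ω Δ Δ' M A v} → Δ ↭ v ∷ Δ' →
  Σ ∣ Γ ⨾ Ω ⨾ Δ ⊢ M ∶ A → Σ ∣ (v ∷ Γ) ⨾ Ω ⨾ Δ' ⊢ M ∶ A
strict⇒unrestricted p (t-con _) = ⊥-elim (¬x∷xs↭[] (↭-sym p))
strict⇒unrestricted p (t-varu _) = ⊥-elim (¬x∷xs↭[] (↭-sym p))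
strict⇒unrestricted p t-var1 with refl ← ↭-singleton-inv (↭-sym p) = t-varu (here refl)
strict⇒unrestricted {Γ = Γ} {Ω = Ω} p (t-lamu fr D) =
  t-lamu (∉-dom-resp-↭ (↭-shiftˡ Γ (↭-shiftˡ Ω p)) fr)
    (⊢-resp-↭ (↭-swap _ _ ↭-refl) ↭-refl ↭-refl (strict⇒unrestricted p D))
strict⇒unrestricted {Γ = Γ} {Ω = Ω} p (t-lam0 fr D) =
  t-lam0 (∉-dom-resp-↭ (↭-shiftˡ Γ (↭-shiftˡ Ω p)) fr) (strict⇒unrestricted p D)
strict⇒unrestricted {Γ = Γ} {Ω = Ω} p (t-lam1 fr D) =
  t-lam1 (∉-dom-resp-↭ (↭-shiftˡ Γ (↭-shiftˡ Ω p)) fr)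
    (strict⇒unrestricted (↭-shiftˡ (_ ∷ []) p) D)
strict⇒unrestricted {Γ = Γ} p (t-appu DM DN) =
  t-appu (strict⇒unrestricted p DM) (⊢-resp-↭ (↭-shiftˡ Γ p) ↭-refl ↭-refl DN)
strict⇒unrestricted {Γ = Γ} {Ω = Ω} p (t-app0 DM DN) =
  t-app0 (strict⇒unrestricted p DM)
    (⊢-resp-↭ (↭-shiftˡ Γ (↭-shiftˡ Ω p)) ↭-refl ↭-refl DN)
strict⇒unrestricted {Γ = Γ} p (t-app1 split DM DN)
  with ∷-↭-++-split (↭-trans (↭-sym p) split)
... | inj₁ (_ , pM , split') =
  t-app1 split' (strict⇒unrestricted pM DM) (⊢-resp-↭ (↭-shiftˡ Γ pM) ↭-refl ↭-refl DN)
... | inj₂ (_ , pN , split') =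
  t-app1 split' (⊢-resp-↭ (↭-shiftˡ Γ pN) ↭-refl ↭-refl DM) (strict⇒unrestricted pN DN)

lemma3p3 : (Σ : Sig) (Γ Ω Δ : Ctx) (x : Var) (C : Ty) (M : Tm) (A : Ty) →
    (WF Γ ((x , C) ∷ Ω) Δ →
      Σ ∣ Γ ⨾ ((x , C) ∷ Ω) ⨾ Δ ⊢ M ∶ A →
      Σ ∣ ((x , C) ∷ Γ) ⨾ Ω ⨾ Δ ⊢ M ∶ A)
    × (WF Γ Ω ((x , C) ∷ Δ) →
      Σ ∣ Γ ⨾ Ω ⨾ ((x , C) ∷ Δ) ⊢ M ∶ A →
      Σ ∣ ((x , C) ∷ Γ) ⨾ Ω ⨾ Δ ⊢ M ∶ A)
lemma3p3 Σ Γ Ω Δ x C M A =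
  (λ _ → irrelevant⇒unrestricted ↭-refl) , (λ _ → strict⇒unrestricted ↭-refl)
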